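{- Let $k\ge 1$ and $n:=2^k$. For every $x\in\langle C_k\rangle$, let $C(x)$ be the closed walk in $Q_n$ that starts at $x$ and has flip sequence $(1,2,\ldots,n,1,2,\ldots,n)$, i.e., the cyclic sequence of vertices $x\oplus\{1,\dots,i\}$ for $i=0,\dots,n$ followed by $x\oplus[n]\oplus\{1,\dots,i\}$ for $i=1,\dots,n-1$. Then each $C(x)$ is an isometric cycle of length $2n$ in $Q_n$, and the cycles $C(x)$ for $x\in\langle C_k\rangle$ form a partition of the vertex set of $Q_n$.
   Context: $[n]:=\{1,\dots,n\}$. The $n$-dimensional hypercube $Q_n$ has as vertices all subsets of $[n]$, with an edge between two sets differing in exactly one element $i$ (an edge of direction $i$). $x\oplus y$ denotes symmetric difference. The flip sequence of a walk is the sequence of directions of its consecutive edges. A subgraph $H$ of a graph $G$ is isometric if $d_H(u,v)=d_G(u,v)$ for all vertices $u,v$ of $H$. For a family $X$ of subsets of $[n]$, $\langle X\rangle$ is the set of all symmetric differences of finitely many members of $X$ (including $\emptyset$). For an integer $t\ge1$, $t\cdot x:=\{ti\mid i\in x\}$ and $t\cdot X:=\{t\cdot x\mid x\in X\}$. Define $O_1:=C_1:=\emptyset$, and for $k\ge 2$: $O_k:=\{\{2i-1,2i+1\}\mid 1\le i\le 2^{k-1}-1\}$ and $C_k:=O_k\cup 2\cdot C_{k-1}$. (All members of $\langle C_k\rangle$ are subsets of $[n-1]$.) -}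

module Defs where

open import Data.Nat using (ℕ; zero; suc; _+_; _*_; _∸_; _^_; _≤_; _≡ᵇ_)
open import Data.Bool using (Bool; _xor_; if_then_else_; true; false)
open import Data.List as List using (List; []; _∷_; _++_; upTo)
open import Data.Bool.ListAction using (any)
open import Data.Vec as Vec using (Vec; []; _∷_; zipWith; tabulate; lookup; replicate; allFin)
open import Data.Fin using (Fin; toℕ; inject₁) renaming (suc to fsuc)
open import Data.Product using (Σ; ∃; _×_; _,_)
open import Data.Sum using (_⊎_)
open import Relation.Binary.PropositionalEquality using (_≡_)
open import Function.Bundles using (_⇔_)
open import Data.List.Membership.Propositional using () renaming (_∈_ to _∈ₗ_)

-- Vertices of Q_n: subsets of [n], as characteristic vectors.
-- Index i : Fin n represents the element (toℕ i + 1) of [n].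

Vertex : ℕ → Set
Vertex n = Vec Bool n

_⊕_ : ∀ {n} → Vertex n → Vertex n → Vertex n
_⊕_ = zipWith _xor_

∅ : ∀ {n} → Vertex n
∅ = replicate _ false

⁅_⁆ : ∀ {n} → Fin n → Vertex n
⁅_⁆ {n} i = tabulate (λ j → toℕ j ≡ᵇ toℕ i)

-- a finite set of positive naturals (1-indexed, as in the paper), viewed as a
-- subset of [n] (elements outside [n] are dropped; for the families used
-- below no element is dropped).
toVertex : (n : ℕ) → List ℕ → Vertex n
toVertex n l = tabulate (λ j → any (λ m → m ≡ᵇ suc (toℕ j)) l)

data Walk {V : Set} (E : V → V → Set) : V → V → ℕ → Set where
  []  : ∀ {u} → Walk E u u 0
  _∷_ : ∀ {u v w m} → E u v → Walk E v w m → Walk E u w (suc m)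

IsDist : {V : Set} → (V → V → Set) → V → V → ℕ → Set
IsDist E u v d = Walk E u v d × (∀ m → Walk E u v m → d ≤ m)

QAdj : ∀ {n} → Vertex n → Vertex n → Set
QAdj {n} u v = ∃ λ (i : Fin n) → v ≡ u ⊕ ⁅ i ⁆

data _∈⟨_⟩ {n : ℕ} : Vertex n → List (Vertex n) → Set where
  span-∅ : ∀ {X} → ∅ ∈⟨ X ⟩
  span-⊕ : ∀ {X a y} → a ∈ₗ X → y ∈⟨ X ⟩ → (a ⊕ y) ∈⟨ X ⟩

-- The families O_k and C_k (as lists of finite sets of naturals).
-- O_k = {{2i-1,2i+1} | 1 ≤ i ≤ 2^(k-1) - 1}   (k ≥ 2); with i = j+1 this is {2j+1, 2j+3}.

O : ℕ → List (List ℕ)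
O zero    = []
O (suc m) = List.map (λ j → (2 * j + 1) ∷ (2 * j + 3) ∷ []) (upTo (2 ^ m ∸ 1))

-- C_1 = ∅, C_k = O_k ∪ 2·C_{k-1}.  (C 0 is unused.)
C : ℕ → List (List ℕ)
C zero = []
C (suc zero) = []
C (suc (suc m)) = O (suc (suc m)) ++ List.map (List.map (2 *_)) (C (suc m))

Cfam : (k n : ℕ) → List (Vertex n)
Cfam k n = List.map (toVertex n) (C k)

flips : (n : ℕ) → Vec (Fin n) (n + n)
flips n = allFin n Vec.++ allFin n

trace : ∀ {n m} → Vertex n → Vec (Fin n) m → Vec (Vertex n) (suc m)
trace x []       = x ∷ []
trace x (i ∷ is) = x ∷ trace (x ⊕ ⁅ i ⁆) is

walkC : ∀ {n} → Vertex n → Vec (Vertex n) (suc (n + n))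
walkC {n} x = trace x (flips n)

cyc : ∀ {n} → Vertex n → Fin (n + n) → Vertex n
cyc x j = lookup (walkC x) (inject₁ j)

cycEnd : ∀ {n} → Vertex n → Vertex n
cycEnd {n} x = Vec.last (walkC x)

OnC : ∀ {n} → Vertex n → Vertex n → Set
OnC {n} x v = ∃ λ (j : Fin (n + n)) → cyc x j ≡ v

CAdj : ∀ {n} → Vertex n → Vertex n → Vertex n → Set
CAdj {n} x u v = ∃ λ (j : Fin (n + n)) →
  (u ≡ lookup (walkC x) (inject₁ j) × v ≡ lookup (walkC x) (fsuc j))
  ⊎ (v ≡ lookup (walkC x) (inject₁ j) × u ≡ lookup (walkC x) (fsuc j))

Isometric : {V : Set} → (P : V → Set) → (EH EG : V → V → Set) → Set
Isometric P EH EG = ∀ u v → P u → P v → ∀ d → (IsDist EH u v d ⇔ IsDist EG u v d)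

-- Read bit t of a vertex as the element t + 1.  Bit t is flipped at steps t and t + n of
-- the flip sequence, so the j-th vertex of C(x) is x ⊕ walkSet n j with
-- walkSet n j = {t | t < j} ⊕ {t | t + n < j}.
--
-- ⟨C_k⟩ consists of the vertices whose even bits (the odd elements, met only by O_k) have
-- even parity and whose odd bits, read as a vertex of Q_{n/2}, lie in ⟨C_{k-1}⟩.  On the odd
-- bits walkSet n (2j) and walkSet n (2j + 1) both restrict to walkSet (n/2) j, while on the
-- even bits they differ in a single position.  By recursion on k, every vertex is therefore
-- x ⊕ walkSet n j for exactly one x ∈ ⟨C_k⟩ and one j < 2n: the cycles partition Q_n.
--
-- For i ≤ j, walkSet n i ⊕ walkSet n j is the set of bits flipped an odd number of times
-- between steps i and j; it has j - i elements if j - i ≤ n and 2n - (j - i) otherwise, the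
-- length of the shorter arc of C(x) between them.  No walk in Q_n is shorter than the Hamming
-- distance of its ends, so C(x) is isometric.

module Submission where

open import Defs
open import Data.Nat using (ℕ; _^_; _≤_; _+_)
open import Data.Fin using (Fin)
open import Data.Product using (∃; _×_)
open import Relation.Binary.PropositionalEquality using (_≡_)

open import Algebra.Bundles using (CommutativeRing)
open import Data.Bool using (Bool; true; false; not; _∧_; _∨_; _xor_; if_then_else_)
open import Data.Bool.ListAction using (any)
open import Data.Bool.Properties
  using (∧-zeroʳ; xor-assoc; xor-comm; xor-same; xor-identityˡ; xor-identityʳ; xor-annihilates-not;
         xor-∧-commutativeRing)
open import Algebra.Properties.CommutativeSemigroup (CommutativeRing.+-commutativeSemigroup xor-∧-commutativeRing)
  using (xy∙z≈xz∙y) renaming (interchange to xor-interchange)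
open import Data.Fin using (toℕ; inject₁; fromℕ; fromℕ<) renaming (zero to fzero; suc to fsuc)
open import Data.Fin.Properties using (toℕ<n; toℕ-inject₁; toℕ-fromℕ; toℕ-fromℕ<; toℕ-injective)
open import Data.List as List using (List; upTo)
open import Data.List.Membership.Propositional using () renaming (_∈_ to _∈ₗ_)
open import Data.List.Membership.Propositional.Properties
  using (∈-map⁻; ∈-map⁺; ∈-++⁻; ∈-++⁺ˡ; ∈-++⁺ʳ; ∈-upTo⁻; ∈-upTo⁺)
open import Data.Nat using (zero; suc; _*_; _∸_; _<_; _≡ᵇ_; _<ᵇ_; z≤n; s≤s; z<s; s<s)
open import Data.Nat.Properties
  using (_<?_; _≤?_; ≤-refl; ≤-reflexive; ≤-trans; ≤-antisym; ≤-pred; <-irrefl; <-trans; <-≤-trans; <⇒≤; ≤⇒≯;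
         ≮⇒≥; ≰⇒>; n<1+n; n≤1+n; m≤m+n; m≤n+m; m≤n⇒m<n∨m≡n; m≤n⇒∃[o]m+o≡n; +-comm; +-assoc; +-suc;
         +-identityʳ; +-monoˡ-≤; +-monoˡ-<; +-cancelʳ-≤; +-cancelˡ-<; m+n∸m≡n; m+n∸n≡m)
open import Data.Product using (_,_)
open import Data.Sum using (_⊎_; inj₁; inj₂; [_,_]′)
open import Data.Vec using (Vec; []; _∷_; _++_; tabulate; lookup; allFin; last)
open import Data.Vec.Properties using (tabulate-cong; zipWith-assoc; zipWith-identityˡ; zipWith-identityʳ)
open import Function using (_∘_)
open import Function.Bundles using (_⇔_; mk⇔)
open import Relation.Binary.PropositionalEquality
  using (_≢_; refl; sym; trans; cong; cong₂; subst; subst₂; module ≡-Reasoning)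
open import Relation.Nullary using (¬_; contradiction; yes; no)

xor-cancelʳ : ∀ a b → (a xor b) xor b ≡ a
xor-cancelʳ a b = trans (xor-assoc a b b) (trans (cong (a xor_) (xor-same b)) (xor-identityʳ a))

xor-cancelˡ : ∀ a b → a xor (a xor b) ≡ b
xor-cancelˡ a b = trans (sym (xor-assoc a a b)) (cong (_xor b) (xor-same a))

xor≡false⇒≡ : ∀ {a b} → a xor b ≡ false → a ≡ b
xor≡false⇒≡ {a} {b} e = trans (sym (xor-cancelʳ a b)) (cong (_xor b) e)

xor-cancel-common : ∀ a b c → (a xor b) xor (a xor c) ≡ b xor c
xor-cancel-common a b c = trans (xor-interchange a b a c) (cong (_xor (b xor c)) (xor-same a))

xor-transpose : ∀ {a b c d} → a xor b ≡ c xor d → a xor c ≡ b xor d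
xor-transpose {a} {b} {c} {d} e = begin
  a xor c                 ≡⟨ sym (xor-cancel-common b a c) ⟩
  (b xor a) xor (b xor c) ≡⟨ cong₂ _xor_ (trans (xor-comm b a) e) (xor-comm b c) ⟩
  (c xor d) xor (c xor b) ≡⟨ xor-cancel-common c d b ⟩
  d xor b                 ≡⟨ xor-comm d b ⟩
  b xor d                 ∎
  where open ≡-Reasoning

<⇒<ᵇ≡true : ∀ {m n} → m < n → (m <ᵇ n) ≡ true
<⇒<ᵇ≡true {zero}  {suc n} _         = refl
<⇒<ᵇ≡true {suc m} {suc n} (s≤s m<n) = <⇒<ᵇ≡true m<n

≥⇒<ᵇ≡false : ∀ {m n} → n ≤ m → (m <ᵇ n) ≡ false
≥⇒<ᵇ≡false {m}     {zero}  _         = refl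
≥⇒<ᵇ≡false {suc m} {suc n} (s≤s n≤m) = ≥⇒<ᵇ≡false n≤m

<ᵇ-suc : ∀ m n → (m <ᵇ suc n) ≡ (m <ᵇ n) xor (m ≡ᵇ n)
<ᵇ-suc zero    zero    = refl
<ᵇ-suc zero    (suc n) = refl
<ᵇ-suc (suc m) zero    = ≥⇒<ᵇ≡false {m} {0} z≤n
<ᵇ-suc (suc m) (suc n) = <ᵇ-suc m n

≡ᵇ-refl : ∀ n → (n ≡ᵇ n) ≡ true
≡ᵇ-refl zero    = refl
≡ᵇ-refl (suc n) = ≡ᵇ-refl n

≡ᵇ-sym : ∀ m n → (m ≡ᵇ n) ≡ (n ≡ᵇ m)
≡ᵇ-sym zero    zero    = refl
≡ᵇ-sym zero    (suc n) = refl
≡ᵇ-sym (suc m) zero    = refl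
≡ᵇ-sym (suc m) (suc n) = ≡ᵇ-sym m n

≢⇒≡ᵇ≡false : ∀ {m n} → m ≢ n → (m ≡ᵇ n) ≡ false
≢⇒≡ᵇ≡false {zero}  {zero}  m≢n = contradiction refl m≢n
≢⇒≡ᵇ≡false {zero}  {suc n} _   = refl
≢⇒≡ᵇ≡false {suc m} {zero}  _   = refl
≢⇒≡ᵇ≡false {suc m} {suc n} m≢n = ≢⇒≡ᵇ≡false (m≢n ∘ cong suc)

double : ℕ → ℕ
double zero    = zero
double (suc n) = suc (suc (double n))

data Parity : ℕ → Set where
  even : ∀ p → Parity (double p)
  odd  : ∀ p → Parity (suc (double p))

parity : ∀ t → Parity t
parity zero = even 0
parity (suc t) with parity t
... | even p = odd p
... | odd  p = even (suc p)

double≡+ : ∀ n → double n ≡ n + n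
double≡+ zero    = refl
double≡+ (suc n) = cong suc (trans (cong suc (double≡+ n)) (sym (+-suc n n)))

double≡2* : ∀ n → double n ≡ 2 * n
double≡2* n = trans (double≡+ n) (cong (n +_) (sym (+-identityʳ n)))

double-distrib-+ : ∀ m n → double (m + n) ≡ double m + double n
double-distrib-+ zero    n = refl
double-distrib-+ (suc m) n = cong (suc ∘ suc) (double-distrib-+ m n)

double-mono-< : ∀ {m n} → m < n → double m < double n
double-mono-< {zero}  {suc n} _         = z<s
double-mono-< {suc m} {suc n} (s≤s m<n) = s<s (s<s (double-mono-< m<n))

double-mono-<′ : ∀ {m n} → m < n → suc (double m) < double n
double-mono-<′ {zero}  {suc n} _         = s<s z<s
double-mono-<′ {suc m} {suc n} (s≤s m<n) = s<s (s<s (double-mono-<′ m<n))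

double-cancel-< : ∀ {m n} → double m < double n → m < n
double-cancel-< {zero}  {suc n} _                 = z<s
double-cancel-< {suc m} {suc n} (s≤s (s≤s 2m<2n)) = s<s (double-cancel-< 2m<2n)

double-cancel-<′ : ∀ {m n} → suc (double m) < double n → m < n
double-cancel-<′ {zero}  {suc n} _                  = z<s
double-cancel-<′ {suc m} {suc n} (s≤s (s≤s 2m<2n)) = s<s (double-cancel-<′ 2m<2n)

double-<ᵇ-double : ∀ m n → (double m <ᵇ double n) ≡ (m <ᵇ n)
double-<ᵇ-double zero    zero    = refl
double-<ᵇ-double zero    (suc n) = refl
double-<ᵇ-double (suc m) zero    = refl
double-<ᵇ-double (suc m) (suc n) = double-<ᵇ-double m n

odd-<ᵇ-double : ∀ m n → (suc (double m) <ᵇ double n) ≡ (m <ᵇ n)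
odd-<ᵇ-double zero    zero    = refl
odd-<ᵇ-double zero    (suc n) = refl
odd-<ᵇ-double (suc m) zero    = refl
odd-<ᵇ-double (suc m) (suc n) = odd-<ᵇ-double m n

double-<ᵇ-odd : ∀ m n → (double m <ᵇ suc (double n)) ≡ (m <ᵇ suc n)
double-<ᵇ-odd zero    n       = refl
double-<ᵇ-odd (suc m) zero    = ≥⇒<ᵇ≡false {double m} {0} z≤n
double-<ᵇ-odd (suc m) (suc n) = double-<ᵇ-odd m n

double-≡ᵇ-double : ∀ m n → (double m ≡ᵇ double n) ≡ (m ≡ᵇ n)
double-≡ᵇ-double zero    zero    = refl
double-≡ᵇ-double zero    (suc n) = refl
double-≡ᵇ-double (suc m) zero    = refl
double-≡ᵇ-double (suc m) (suc n) = double-≡ᵇ-double m n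

double-≡ᵇ-odd : ∀ m n → (double m ≡ᵇ suc (double n)) ≡ false
double-≡ᵇ-odd zero          n       = refl
double-≡ᵇ-odd (suc zero)    zero    = refl
double-≡ᵇ-odd (suc (suc m)) zero    = refl
double-≡ᵇ-odd (suc m)       (suc n) = double-≡ᵇ-odd m n

exp₂ : ℕ → ℕ
exp₂ zero    = 1
exp₂ (suc k) = double (exp₂ k)

exp₂≡2^ : ∀ k → exp₂ k ≡ 2 ^ k
exp₂≡2^ zero    = refl
exp₂≡2^ (suc k) = trans (double≡2* (exp₂ k)) (cong (2 *_) (exp₂≡2^ k))

xorSum : (ℕ → Bool) → ℕ → Bool
xorSum f zero    = false
xorSum f (suc n) = xorSum f n xor f n

xorSum-cong : ∀ n {f g} → (∀ t → t < n → f t ≡ g t) → xorSum f n ≡ xorSum g n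
xorSum-cong zero    f≗g = refl
xorSum-cong (suc n) f≗g =
  cong₂ _xor_ (xorSum-cong n (λ t t<n → f≗g t (<-trans t<n (n<1+n n)))) (f≗g n (n<1+n n))

xorSum-xor : ∀ n f g → xorSum (λ t → f t xor g t) n ≡ xorSum f n xor xorSum g n
xorSum-xor zero    f g = refl
xorSum-xor (suc n) f g =
  trans (cong (_xor (f n xor g n)) (xorSum-xor n f g)) (xor-interchange (xorSum f n) (xorSum g n) (f n) (g n))

xorSum-false : ∀ n → xorSum (λ _ → false) n ≡ false
xorSum-false zero    = refl
xorSum-false (suc n) = trans (xor-identityʳ _) (xorSum-false n)

xorSum-suc : ∀ n f → xorSum f (suc n) ≡ f 0 xor xorSum (f ∘ suc) n
xorSum-suc zero    f = xor-comm false (f 0)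
xorSum-suc (suc n) f = trans (cong (_xor f (suc n)) (xorSum-suc n f)) (xor-assoc (f 0) _ _)

xorSum-+-≡ᵇ : ∀ n a c → xorSum (λ p → p + a ≡ᵇ c) n ≡ (c <ᵇ a) xor (c <ᵇ a + n)
xorSum-+-≡ᵇ zero a c rewrite +-identityʳ a = sym (xor-same (c <ᵇ a))
xorSum-+-≡ᵇ (suc n) a c
  rewrite +-suc a n | <ᵇ-suc c (a + n) | xorSum-+-≡ᵇ n a c | +-comm n a | ≡ᵇ-sym (a + n) c =
  xor-assoc (c <ᵇ a) _ _

xorSum-≡ᵇ : ∀ n c → xorSum (_≡ᵇ c) n ≡ (c <ᵇ n)
xorSum-≡ᵇ n c = trans (xorSum-cong n (λ p _ → cong (_≡ᵇ c) (sym (+-identityʳ p)))) (xorSum-+-≡ᵇ n 0 c)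

-- The parity checks of ⟨C_k⟩

ParityChecks : ℕ → (ℕ → Bool) → Set
ParityChecks zero    f = f 0 ≡ false
ParityChecks (suc k) f = xorSum (f ∘ double) (exp₂ k) ≡ false × ParityChecks k (f ∘ suc ∘ double)

ParityChecks-cong : ∀ k {f g} → (∀ t → t < exp₂ k → f t ≡ g t) → ParityChecks k f → ParityChecks k g
ParityChecks-cong zero    f≗g f0 = trans (sym (f≗g 0 z<s)) f0
ParityChecks-cong (suc k) f≗g (evenCheck , oddChecks) =
  trans (sym (xorSum-cong (exp₂ k) (λ p p< → f≗g (double p) (double-mono-< p<)))) evenCheck ,
  ParityChecks-cong k (λ p p< → f≗g (suc (double p)) (double-mono-<′ p<)) oddChecks

ParityChecks-false : ∀ k → ParityChecks k (λ _ → false)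
ParityChecks-false zero    = refl
ParityChecks-false (suc k) = xorSum-false (exp₂ k) , ParityChecks-false k

ParityChecks-xor : ∀ k {f g} → ParityChecks k f → ParityChecks k g → ParityChecks k (λ t → f t xor g t)
ParityChecks-xor zero    f0 g0 = cong₂ _xor_ f0 g0
ParityChecks-xor (suc k) {f} {g} (fEven , fOdd) (gEven , gOdd) =
  trans (xorSum-xor (exp₂ k) (f ∘ double) (g ∘ double)) (cong₂ _xor_ fEven gEven) ,
  ParityChecks-xor k fOdd gOdd

walkSet : ℕ → ℕ → ℕ → Bool
walkSet n j t = (t <ᵇ j) xor (t + n <ᵇ j)

stepFlip : ℕ → ℕ → ℕ → Bool
stepFlip n j t = (t ≡ᵇ j) xor (t + n ≡ᵇ j)

walkSet-suc : ∀ n j t → walkSet n (suc j) t ≡ walkSet n j t xor stepFlip n j t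
walkSet-suc n j t rewrite <ᵇ-suc t j | <ᵇ-suc (t + n) j =
  xor-interchange (t <ᵇ j) (t ≡ᵇ j) (t + n <ᵇ j) (t + n ≡ᵇ j)

xorSum-stepFlip : ∀ n {j} → j < double n → xorSum (stepFlip n j) n ≡ true
xorSum-stepFlip n {j} j<2n = begin
  xorSum (stepFlip n j) n
    ≡⟨ xorSum-xor n (_≡ᵇ j) (λ t → t + n ≡ᵇ j) ⟩
  xorSum (_≡ᵇ j) n xor xorSum (λ t → t + n ≡ᵇ j) n
    ≡⟨ cong₂ _xor_ (xorSum-≡ᵇ n j) (xorSum-+-≡ᵇ n n j) ⟩
  (j <ᵇ n) xor ((j <ᵇ n) xor (j <ᵇ n + n))
    ≡⟨ xor-cancelˡ (j <ᵇ n) (j <ᵇ n + n) ⟩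
  (j <ᵇ n + n)
    ≡⟨ <⇒<ᵇ≡true (subst (j <_) (double≡+ n) j<2n) ⟩
  true ∎
  where open ≡-Reasoning

walkSet-even-even : ∀ n j p → walkSet (double n) (double j) (double p) ≡ walkSet n j p
walkSet-even-even n j p
  rewrite sym (double-distrib-+ p n) | double-<ᵇ-double p j | double-<ᵇ-double (p + n) j = refl

walkSet-odd-even : ∀ n j p → walkSet (double n) (suc (double j)) (double p) ≡ walkSet n (suc j) p
walkSet-odd-even n j p
  rewrite sym (double-distrib-+ p n) | double-<ᵇ-odd p j | double-<ᵇ-odd (p + n) j = refl

walkSet-even-odd : ∀ n j p → walkSet (double n) (double j) (suc (double p)) ≡ walkSet n j p
walkSet-even-odd n j p
  rewrite sym (double-distrib-+ p n) | odd-<ᵇ-double p j | odd-<ᵇ-double (p + n) j = refl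

walkSet-odd-odd : ∀ n j p → walkSet (double n) (suc (double j)) (suc (double p)) ≡ walkSet n j p
walkSet-odd-odd n j p
  rewrite sym (double-distrib-+ p n) | double-<ᵇ-double p j | double-<ᵇ-double (p + n) j = refl

-- Decomposition along the cycles

walkSet-decompose : ∀ k (f : ℕ → Bool) →
  ∃ λ j → j < double (exp₂ k) × ParityChecks k (λ t → f t xor walkSet (exp₂ k) j t)
walkSet-decompose zero f with f 0
... | false = 0 , z<s , refl
... | true  = 1 , s<s z<s , refl
walkSet-decompose (suc k) f with walkSet-decompose k (f ∘ suc ∘ double)
... | j , j< , oddChecks with xorSum (λ p → f (double p) xor walkSet (exp₂ k) j p) (exp₂ k) in evenParity
... | false = double j , double-mono-< j< ,
  trans (xorSum-cong (exp₂ k) (λ p _ → cong (f (double p) xor_) (walkSet-even-even (exp₂ k) j p))) evenParity ,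
  ParityChecks-cong k (λ p _ → cong (f (suc (double p)) xor_) (sym (walkSet-even-odd (exp₂ k) j p))) oddChecks
... | true = suc (double j) , double-mono-<′ j< , evenCheck ,
  ParityChecks-cong k (λ p _ → cong (f (suc (double p)) xor_) (sym (walkSet-odd-odd (exp₂ k) j p))) oddChecks
  where
  M : ℕ
  M = exp₂ k
  g : ℕ → Bool
  g p = f (double p) xor walkSet M j p
  evenCheck : xorSum (λ p → f (double p) xor walkSet (double M) (suc (double j)) (double p)) M ≡ false
  evenCheck = begin
    xorSum (λ p → f (double p) xor walkSet (double M) (suc (double j)) (double p)) M
      ≡⟨ xorSum-cong M (λ p _ → cong (f (double p) xor_) (trans (walkSet-odd-even M j p) (walkSet-suc M j p))) ⟩
    xorSum (λ p → f (double p) xor (walkSet M j p xor stepFlip M j p)) M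
      ≡⟨ xorSum-cong M (λ p _ → sym (xor-assoc (f (double p)) _ _)) ⟩
    xorSum (λ p → g p xor stepFlip M j p) M
      ≡⟨ xorSum-xor M g (stepFlip M j) ⟩
    xorSum g M xor xorSum (stepFlip M j) M
      ≡⟨ cong₂ _xor_ evenParity (xorSum-stepFlip M j<) ⟩
    false ∎
    where open ≡-Reasoning

walkSet-unique : ∀ k {i j} → i < double (exp₂ k) → j < double (exp₂ k) →
  ParityChecks k (λ t → walkSet (exp₂ k) i t xor walkSet (exp₂ k) j t) → i ≡ j

walkSet-even≢odd : ∀ k {i j} → i < double (exp₂ k) → j < double (exp₂ k) →
  ¬ ParityChecks (suc k) (λ t → walkSet (exp₂ (suc k)) (double i) t xor walkSet (exp₂ (suc k)) (suc (double j)) t)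

walkSet-unique zero {0}           {0}           _ _ _  = refl
walkSet-unique zero {1}           {1}           _ _ _  = refl
walkSet-unique zero {0}           {1}           _ _ ()
walkSet-unique zero {1}           {0}           _ _ ()
walkSet-unique zero {suc (suc i)} {j}           (s≤s (s≤s ())) _
walkSet-unique zero {i}           {suc (suc j)} _ (s≤s (s≤s ()))
walkSet-unique (suc k) {i} {j} i< j< checks@(_ , oddChecks) with parity i | parity j
... | even i′ | even j′ = cong double (walkSet-unique k (double-cancel-< i<) (double-cancel-< j<)
  (ParityChecks-cong k (λ p _ → cong₂ _xor_ (walkSet-even-odd M i′ p) (walkSet-even-odd M j′ p)) oddChecks))
  where
  M : ℕ
  M = exp₂ k
... | odd i′ | odd j′ = cong (suc ∘ double) (walkSet-unique k (double-cancel-<′ i<) (double-cancel-<′ j<)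
  (ParityChecks-cong k (λ p _ → cong₂ _xor_ (walkSet-odd-odd M i′ p) (walkSet-odd-odd M j′ p)) oddChecks))
  where
  M : ℕ
  M = exp₂ k
... | even i′ | odd j′ = contradiction checks (walkSet-even≢odd k (double-cancel-< i<) (double-cancel-<′ j<))
... | odd i′ | even j′ = contradiction
  (ParityChecks-cong (suc k) (λ t _ → xor-comm (walkSet M (suc (double i′)) t) (walkSet M (double j′) t)) checks)
  (walkSet-even≢odd k (double-cancel-< j<) (double-cancel-<′ i<))
  where
  M : ℕ
  M = exp₂ (suc k)

walkSet-even≢odd k {i} {j} i< j< (evenCheck , oddChecks)
  with walkSet-unique k i< j< (ParityChecks-cong k
         (λ p _ → cong₂ _xor_ (walkSet-even-odd (exp₂ k) i p) (walkSet-odd-odd (exp₂ k) j p)) oddChecks)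
... | refl = true≢false (begin
  true
    ≡⟨ sym (xorSum-stepFlip M i<) ⟩
  xorSum (stepFlip M i) M
    ≡⟨ xorSum-cong M (λ p _ → step p) ⟩
  xorSum (λ p → walkSet (double M) (double i) (double p) xor walkSet (double M) (suc (double i)) (double p)) M
    ≡⟨ evenCheck ⟩
  false ∎)
  where
  open ≡-Reasoning
  M : ℕ
  M = exp₂ k
  true≢false : true ≢ false
  true≢false ()
  step : ∀ p →
    stepFlip M i p ≡ walkSet (double M) (double i) (double p) xor walkSet (double M) (suc (double i)) (double p)
  step p = sym (trans (cong₂ _xor_ (walkSet-even-even M i p) (trans (walkSet-odd-even M i p) (walkSet-suc M i p)))
                      (xor-cancelˡ (walkSet M i p) (stepFlip M i p)))

bit : ∀ {n} → Vertex n → ℕ → Bool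
bit []      t       = false
bit (b ∷ v) zero    = b
bit (b ∷ v) (suc t) = bit v t

bit-ext : ∀ {n} {u v : Vertex n} → (∀ t → t < n → bit u t ≡ bit v t) → u ≡ v
bit-ext {u = []}    {[]}    _   = refl
bit-ext {u = a ∷ u} {b ∷ v} u≗v = cong₂ _∷_ (u≗v 0 z<s) (bit-ext (λ t t<n → u≗v (suc t) (s<s t<n)))

bit-⊕ : ∀ {n} (u v : Vertex n) t → bit (u ⊕ v) t ≡ bit u t xor bit v t
bit-⊕ []      []      t       = refl
bit-⊕ (a ∷ u) (b ∷ v) zero    = refl
bit-⊕ (a ∷ u) (b ∷ v) (suc t) = bit-⊕ u v t

bit-∅ : ∀ n t → bit (∅ {n}) t ≡ false
bit-∅ zero    t       = refl
bit-∅ (suc n) zero    = refl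
bit-∅ (suc n) (suc t) = bit-∅ n t

-- toVertex n l and ⁅ i ⁆ are, definitionally, fromBits of their characteristic functions.
fromBits : (n : ℕ) → (ℕ → Bool) → Vertex n
fromBits n f = tabulate (f ∘ toℕ)

bit-fromBits : ∀ n f t → t < n → bit (fromBits n f) t ≡ f t
bit-fromBits (suc n) f zero    _         = refl
bit-fromBits (suc n) f (suc t) (s≤s t<n) = bit-fromBits n (f ∘ suc) t t<n

fromBits-cong : ∀ n {f g} → (∀ t → t < n → f t ≡ g t) → fromBits n f ≡ fromBits n g
fromBits-cong n f≗g = tabulate-cong (λ j → f≗g (toℕ j) (toℕ<n j))

fromBits-false : ∀ n {f} → (∀ t → t < n → f t ≡ false) → fromBits n f ≡ ∅
fromBits-false n f≗0 = bit-ext (λ t t<n → trans (bit-fromBits n _ t t<n) (trans (f≗0 t t<n) (sym (bit-∅ n t))))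

fromBits-xor : ∀ n f g → fromBits n (λ t → f t xor g t) ≡ fromBits n f ⊕ fromBits n g
fromBits-xor n f g = bit-ext λ t t<n → trans (bit-fromBits n _ t t<n)
  (sym (trans (bit-⊕ (fromBits n f) _ t) (cong₂ _xor_ (bit-fromBits n f t t<n) (bit-fromBits n g t t<n))))

∈⟨⟩-⊕ : ∀ {n} {X : List (Vertex n)} {a b} → a ∈⟨ X ⟩ → b ∈⟨ X ⟩ → (a ⊕ b) ∈⟨ X ⟩
∈⟨⟩-⊕ {X = X} {b = b} span-∅ b∈ = subst (_∈⟨ X ⟩) (sym (zipWith-identityˡ xor-identityˡ b)) b∈
∈⟨⟩-⊕ {X = X} {b = b} (span-⊕ {a = g} {y = y} g∈ y∈) b∈ =
  subst (_∈⟨ X ⟩) (sym (zipWith-assoc xor-assoc g y b)) (span-⊕ g∈ (∈⟨⟩-⊕ y∈ b∈))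

∈⟨⟩-member : ∀ {n} {X : List (Vertex n)} {a} → a ∈ₗ X → a ∈⟨ X ⟩
∈⟨⟩-member {X = X} {a} a∈ = subst (_∈⟨ X ⟩) (zipWith-identityʳ xor-identityʳ a) (span-⊕ a∈ span-∅)

∈⟨⟩-hom : ∀ {m n} {X : List (Vertex m)} {Y : List (Vertex n)} (φ : Vertex m → Vertex n) →
  φ ∅ ≡ ∅ → (∀ a b → φ (a ⊕ b) ≡ φ a ⊕ φ b) → (∀ {a} → a ∈ₗ X → φ a ∈⟨ Y ⟩) →
  ∀ {x} → x ∈⟨ X ⟩ → φ x ∈⟨ Y ⟩
∈⟨⟩-hom {Y = Y} φ φ∅ φ⊕ φX span-∅ = subst (_∈⟨ Y ⟩) (sym φ∅) span-∅
∈⟨⟩-hom {Y = Y} φ φ∅ φ⊕ φX (span-⊕ {a = a} {y = y} a∈ y∈) =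
  subst (_∈⟨ Y ⟩) (sym (φ⊕ a y)) (∈⟨⟩-⊕ (φX a∈) (∈⟨⟩-hom φ φ∅ φ⊕ φX y∈))

spreadEven : (ℕ → Bool) → ℕ → Bool
spreadEven g zero          = g 0
spreadEven g (suc zero)    = false
spreadEven g (suc (suc t)) = spreadEven (g ∘ suc) t

spreadOdd : (ℕ → Bool) → ℕ → Bool
spreadOdd g zero          = false
spreadOdd g (suc zero)    = g 0
spreadOdd g (suc (suc t)) = spreadOdd (g ∘ suc) t

spreadEven-even : ∀ g p → spreadEven g (double p) ≡ g p
spreadEven-even g zero    = refl
spreadEven-even g (suc p) = spreadEven-even (g ∘ suc) p

spreadEven-odd : ∀ g p → spreadEven g (suc (double p)) ≡ false
spreadEven-odd g zero    = refl
spreadEven-odd g (suc p) = spreadEven-odd (g ∘ suc) p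

spreadOdd-even : ∀ g p → spreadOdd g (double p) ≡ false
spreadOdd-even g zero    = refl
spreadOdd-even g (suc p) = spreadOdd-even (g ∘ suc) p

spreadOdd-odd : ∀ g p → spreadOdd g (suc (double p)) ≡ g p
spreadOdd-odd g zero    = refl
spreadOdd-odd g (suc p) = spreadOdd-odd (g ∘ suc) p

spread-split : ∀ f t → f t ≡ spreadEven (f ∘ double) t xor spreadOdd (f ∘ suc ∘ double) t
spread-split f t with parity t
... | even p rewrite spreadEven-even (f ∘ double) p | spreadOdd-even (f ∘ suc ∘ double) p = sym (xor-identityʳ _)
... | odd p rewrite spreadEven-odd (f ∘ double) p | spreadOdd-odd (f ∘ suc ∘ double) p = refl

spreadEven-xor : ∀ f g t → spreadEven (λ p → f p xor g p) t ≡ spreadEven f t xor spreadEven g t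
spreadEven-xor f g zero          = refl
spreadEven-xor f g (suc zero)    = refl
spreadEven-xor f g (suc (suc t)) = spreadEven-xor (f ∘ suc) (g ∘ suc) t

spreadOdd-xor : ∀ f g t → spreadOdd (λ p → f p xor g p) t ≡ spreadOdd f t xor spreadOdd g t
spreadOdd-xor f g zero          = refl
spreadOdd-xor f g (suc zero)    = refl
spreadOdd-xor f g (suc (suc t)) = spreadOdd-xor (f ∘ suc) (g ∘ suc) t

spreadOdd-cong : ∀ n {f g} → (∀ p → p < n → f p ≡ g p) → ∀ t → t < double n → spreadOdd f t ≡ spreadOdd g t
spreadOdd-cong n f≗g t t<2n with parity t
... | even p = trans (spreadOdd-even _ p) (sym (spreadOdd-even _ p))
... | odd p  = trans (spreadOdd-odd _ p) (trans (f≗g p (double-cancel-<′ t<2n)) (sym (spreadOdd-odd _ p)))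

ParityChecks-spreadEven : ∀ k {g} → xorSum g (exp₂ k) ≡ false → ParityChecks (suc k) (spreadEven g)
ParityChecks-spreadEven k {g} evenParity =
  trans (xorSum-cong (exp₂ k) (λ p _ → spreadEven-even g p)) evenParity ,
  ParityChecks-cong k (λ p _ → sym (spreadEven-odd g p)) (ParityChecks-false k)

ParityChecks-spreadOdd : ∀ k {g} → ParityChecks k g → ParityChecks (suc k) (spreadOdd g)
ParityChecks-spreadOdd k {g} checks =
  trans (xorSum-cong (exp₂ k) (λ p _ → spreadOdd-even g p)) (xorSum-false (exp₂ k)) ,
  ParityChecks-cong k (λ p _ → sym (spreadOdd-odd g p)) checks

indicator : List ℕ → ℕ → Bool
indicator l t = any (_≡ᵇ suc t) l

pairGen : ℕ → List ℕ
pairGen j = (2 * j + 1) List.∷ (2 * j + 3) List.∷ List.[]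

pairIndicator : ℕ → ℕ → Bool
pairIndicator j p = (p ≡ᵇ j) xor (p ≡ᵇ suc j)

xorSum-pairIndicator : ∀ n {j} → suc j < n → xorSum (pairIndicator j) n ≡ false
xorSum-pairIndicator n {j} sj<n =
  trans (xorSum-xor n (_≡ᵇ j) (_≡ᵇ suc j))
        (cong₂ _xor_ (trans (xorSum-≡ᵇ n j) (<⇒<ᵇ≡true (<-trans (n<1+n j) sj<n)))
                     (trans (xorSum-≡ᵇ n (suc j)) (<⇒<ᵇ≡true sj<n)))

∈-upTo-pred⁻ : ∀ {n j} → j ∈ₗ upTo (n ∸ 1) → suc j < n
∈-upTo-pred⁻ {suc n} j∈ = s<s (∈-upTo⁻ j∈)

∈-upTo-pred⁺ : ∀ {n j} → suc j < n → j ∈ₗ upTo (n ∸ 1)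
∈-upTo-pred⁺ {suc n} (s≤s j<n) = ∈-upTo⁺ j<n

2*j+1≡odd : ∀ j → 2 * j + 1 ≡ suc (double j)
2*j+1≡odd j = trans (+-comm (2 * j) 1) (cong suc (sym (double≡2* j)))

2*j+3≡odd : ∀ j → 2 * j + 3 ≡ suc (double (suc j))
2*j+3≡odd j = trans (+-comm (2 * j) 3) (cong (suc ∘ suc ∘ suc) (sym (double≡2* j)))

≡ᵇ-∨-≡ᵇ-suc : ∀ j p → (j ≡ᵇ p) ∨ ((suc j ≡ᵇ p) ∨ false) ≡ pairIndicator j p
≡ᵇ-∨-≡ᵇ-suc zero    zero          = refl
≡ᵇ-∨-≡ᵇ-suc zero    (suc zero)    = refl
≡ᵇ-∨-≡ᵇ-suc zero    (suc (suc p)) = refl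
≡ᵇ-∨-≡ᵇ-suc (suc j) zero          = refl
≡ᵇ-∨-≡ᵇ-suc (suc j) (suc p)       = ≡ᵇ-∨-≡ᵇ-suc j p

indicator-pairGen : ∀ j t → indicator (pairGen j) t ≡ spreadEven (pairIndicator j) t
indicator-pairGen j t rewrite 2*j+1≡odd j | 2*j+3≡odd j with parity t
... | even p rewrite spreadEven-even (pairIndicator j) p | double-≡ᵇ-double j p | double-≡ᵇ-double (suc j) p =
  ≡ᵇ-∨-≡ᵇ-suc j p
... | odd p rewrite spreadEven-odd (pairIndicator j) p | double-≡ᵇ-odd j p | double-≡ᵇ-odd (suc j) p = refl

indicator-double : ∀ l t → indicator (List.map (2 *_) l) t ≡ spreadOdd (indicator l) t
indicator-double l t with parity t
... | even p = trans (go l) (sym (spreadOdd-even (indicator l) p))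
  where
  go : ∀ l → indicator (List.map (2 *_) l) (double p) ≡ false
  go List.[]       = refl
  go (m List.∷ l) rewrite sym (double≡2* m) | double-≡ᵇ-odd m p = go l
... | odd p = trans (go l) (sym (spreadOdd-odd (indicator l) p))
  where
  go : ∀ l → indicator (List.map (2 *_) l) (suc (double p)) ≡ indicator l p
  go List.[]       = refl
  go (m List.∷ l) rewrite sym (double≡2* m) | double-≡ᵇ-double m (suc p) = cong ((m ≡ᵇ suc p) ∨_) (go l)

pairIndicator-suc : ∀ j → pairIndicator j (suc j) ≡ true
pairIndicator-suc j rewrite ≢⇒≡ᵇ≡false {suc j} {j} (λ e → <-irrefl (sym e) (n<1+n j)) | ≡ᵇ-refl j = refl

pairIndicator-> : ∀ j {p} → suc j < p → pairIndicator j p ≡ false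
pairIndicator-> j {p} sj<p
  rewrite ≢⇒≡ᵇ≡false {p} {j} (λ e → <-irrefl (sym e) (<-trans (n<1+n j) sj<p))
        | ≢⇒≡ᵇ≡false {p} {suc j} (λ e → <-irrefl (sym e) sj<p) = refl

xorSum-pairIndicator-suc : ∀ j → xorSum (pairIndicator j) (suc j) ≡ true
xorSum-pairIndicator-suc j =
  trans (xorSum-xor (suc j) (_≡ᵇ j) (_≡ᵇ suc j))
        (cong₂ _xor_ (trans (xorSum-≡ᵇ (suc j) j) (<⇒<ᵇ≡true (n<1+n j)))
                     (trans (xorSum-≡ᵇ (suc j) (suc j)) (≥⇒<ᵇ≡false (≤-refl {suc j}))))

-- ⟨C_k⟩ and the parity checks

∈-C⁻ : ∀ m {l} → l ∈ₗ C (suc (suc m)) →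
  (∃ λ j → suc j < exp₂ (suc m) × l ≡ pairGen j) ⊎ (∃ λ l′ → l′ ∈ₗ C (suc m) × l ≡ List.map (2 *_) l′)
∈-C⁻ m l∈ with ∈-++⁻ (O (suc (suc m))) l∈
... | inj₁ l∈O  = let j , j∈ , l≡ = ∈-map⁻ pairGen l∈O in
  inj₁ (j , subst (suc j <_) (sym (exp₂≡2^ (suc m))) (∈-upTo-pred⁻ j∈) , l≡)
... | inj₂ l∈2C = inj₂ (∈-map⁻ (List.map (2 *_)) l∈2C)

ParityChecks-generators : ∀ k {l} → l ∈ₗ C k → ParityChecks k (indicator l)
ParityChecks-generators zero ()
ParityChecks-generators (suc zero) ()
-- The recursive call is made in this clause so that the termination checker sees k decrease.
ParityChecks-generators (suc (suc m)) {l} l∈ =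
  [ pairCase , doubleCase (ParityChecks-generators (suc m)) ]′ (∈-C⁻ m l∈)
  where
  pairCase : (∃ λ j → suc j < exp₂ (suc m) × l ≡ pairGen j) → ParityChecks (suc (suc m)) (indicator l)
  pairCase (j , sj< , refl) = ParityChecks-cong (suc (suc m)) (λ t _ → sym (indicator-pairGen j t))
    (ParityChecks-spreadEven (suc m) (xorSum-pairIndicator (exp₂ (suc m)) sj<))
  doubleCase : (∀ {l′} → l′ ∈ₗ C (suc m) → ParityChecks (suc m) (indicator l′)) →
    (∃ λ l′ → l′ ∈ₗ C (suc m) × l ≡ List.map (2 *_) l′) → ParityChecks (suc (suc m)) (indicator l)
  doubleCase ih (l′ , l′∈ , refl) = ParityChecks-cong (suc (suc m)) (λ t _ → sym (indicator-double l′ t))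
    (ParityChecks-spreadOdd (suc m) (ih l′∈))

∈⟨C⟩⇒ParityChecks : ∀ k {x : Vertex (exp₂ k)} → x ∈⟨ Cfam k (exp₂ k) ⟩ → ParityChecks k (bit x)
∈⟨C⟩⇒ParityChecks k span-∅ = ParityChecks-cong k (λ t _ → sym (bit-∅ (exp₂ k) t)) (ParityChecks-false k)
∈⟨C⟩⇒ParityChecks k (span-⊕ {a = a} {y = y} a∈ y∈) with ∈-map⁻ (toVertex (exp₂ k)) a∈
... | l , l∈ , refl = ParityChecks-cong k (λ t _ → sym (bit-⊕ (toVertex (exp₂ k) l) y t))
  (ParityChecks-xor k (ParityChecks-cong k (λ t t< → sym (bit-fromBits (exp₂ k) (indicator l) t t<))
                                           (ParityChecks-generators k l∈))
                      (∈⟨C⟩⇒ParityChecks k y∈))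

pairGen-∈⟨C⟩ : ∀ m {j} → suc j < exp₂ (suc m) →
  toVertex (exp₂ (suc (suc m))) (pairGen j) ∈⟨ Cfam (suc (suc m)) (exp₂ (suc (suc m))) ⟩
pairGen-∈⟨C⟩ m {j} sj< = ∈⟨⟩-member (∈-map⁺ (toVertex _) (∈-++⁺ˡ (∈-map⁺ pairGen j∈)))
  where
  j∈ : j ∈ₗ upTo (2 ^ suc m ∸ 1)
  j∈ = ∈-upTo-pred⁺ (subst (suc j <_) (exp₂≡2^ (suc m)) sj<)

vanish-extend : ∀ {g : ℕ → Bool} {N B} → g N ≡ false → (∀ p → suc N ≤ p → p < B → g p ≡ false) →
  ∀ p → N ≤ p → p < B → g p ≡ false
vanish-extend {g} gN vanish p N≤p p<B with m≤n⇒m<n∨m≡n N≤p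
... | inj₁ N<p = vanish p N<p p<B
... | inj₂ refl = gN

-- Gaussian elimination from the top: the generator {2M+1, 2M+3} moves the last
-- nonzero even bit one step down.
spreadEven-∈⟨C⟩-step : ∀ m M {g} → suc (suc M) ≤ exp₂ (suc m) → xorSum g (suc (suc M)) ≡ false →
  (∀ p → suc (suc M) ≤ p → p < exp₂ (suc m) → g p ≡ false) →
  (∀ {g′} → xorSum g′ (suc M) ≡ false → (∀ p → suc M ≤ p → p < exp₂ (suc m) → g′ p ≡ false) →
     fromBits (exp₂ (suc (suc m))) (spreadEven g′) ∈⟨ Cfam (suc (suc m)) (exp₂ (suc (suc m))) ⟩) →
  fromBits (exp₂ (suc (suc m))) (spreadEven g) ∈⟨ Cfam (suc (suc m)) (exp₂ (suc (suc m))) ⟩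
spreadEven-∈⟨C⟩-step m M {g} N≤ parity vanish ih with g (suc M) in gsM
... | false = ih (trans (sym (xor-identityʳ _)) parity) (vanish-extend gsM vanish)
... | true = subst (_∈⟨ _ ⟩) (sym reduce) (∈⟨⟩-⊕ (pairGen-∈⟨C⟩ m N≤) (ih parity′ vanish′))
  where
  n : ℕ
  n = exp₂ (suc (suc m))
  g′ : ℕ → Bool
  g′ p = g p xor pairIndicator M p
  parity′ : xorSum g′ (suc M) ≡ false
  parity′ = trans (xorSum-xor (suc M) g (pairIndicator M))
                  (cong₂ _xor_ (xor≡false⇒≡ {xorSum g (suc M)} parity) (xorSum-pairIndicator-suc M))
  vanish′ : ∀ p → suc M ≤ p → p < exp₂ (suc m) → g′ p ≡ false
  vanish′ = vanish-extend (cong₂ _xor_ gsM (pairIndicator-suc M))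
    (λ p ssM≤p p< → cong₂ _xor_ (vanish p ssM≤p p<) (pairIndicator-> M ssM≤p))
  reduce : fromBits n (spreadEven g) ≡ toVertex n (pairGen M) ⊕ fromBits n (spreadEven g′)
  reduce = trans (fromBits-cong n (λ t _ → pointwise t)) (fromBits-xor n (indicator (pairGen M)) (spreadEven g′))
    where
    open ≡-Reasoning
    pointwise : ∀ t → spreadEven g t ≡ indicator (pairGen M) t xor spreadEven g′ t
    pointwise t = begin
      spreadEven g t
        ≡⟨ sym (xor-cancelˡ (spreadEven (pairIndicator M) t) (spreadEven g t)) ⟩
      spreadEven (pairIndicator M) t xor (spreadEven (pairIndicator M) t xor spreadEven g t)
        ≡⟨ cong₂ _xor_ (sym (indicator-pairGen M t))
                       (trans (xor-comm _ (spreadEven g t)) (sym (spreadEven-xor g (pairIndicator M) t))) ⟩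
      indicator (pairGen M) t xor spreadEven g′ t ∎

spreadEven-∈⟨C⟩ : ∀ m N {g} → N ≤ exp₂ (suc m) → xorSum g N ≡ false →
  (∀ p → N ≤ p → p < exp₂ (suc m) → g p ≡ false) →
  fromBits (exp₂ (suc (suc m))) (spreadEven g) ∈⟨ Cfam (suc (suc m)) (exp₂ (suc (suc m))) ⟩
spreadEven-∈⟨C⟩ m zero {g} _ _ vanish = subst (_∈⟨ _ ⟩) (sym (fromBits-false _ allZero)) span-∅
  where
  allZero : ∀ t → t < exp₂ (suc (suc m)) → spreadEven g t ≡ false
  allZero t t< with parity t
  ... | even p = trans (spreadEven-even g p) (vanish p z≤n (double-cancel-< t<))
  ... | odd p  = spreadEven-odd g p
spreadEven-∈⟨C⟩ m (suc zero) N≤ g0 vanish = spreadEven-∈⟨C⟩ m zero z≤n refl (vanish-extend g0 vanish)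
spreadEven-∈⟨C⟩ m (suc (suc M)) N≤ parity vanish =
  spreadEven-∈⟨C⟩-step m M N≤ parity vanish (spreadEven-∈⟨C⟩ m (suc M) (<⇒≤ N≤))

spreadOdd-false : ∀ t → spreadOdd (λ _ → false) t ≡ false
spreadOdd-false zero          = refl
spreadOdd-false (suc zero)    = refl
spreadOdd-false (suc (suc t)) = spreadOdd-false t

spreadOddᵛ : ∀ {m} n → Vertex m → Vertex n
spreadOddᵛ n v = fromBits n (spreadOdd (bit v))

spreadOddᵛ-∈⟨C⟩ : ∀ m {y} → y ∈⟨ Cfam (suc m) (exp₂ (suc m)) ⟩ →
  spreadOddᵛ (exp₂ (suc (suc m))) y ∈⟨ Cfam (suc (suc m)) (exp₂ (suc (suc m))) ⟩
spreadOddᵛ-∈⟨C⟩ m = ∈⟨⟩-hom (spreadOddᵛ n) preserves-∅ preserves-⊕ generators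
  where
  M : ℕ
  M = exp₂ (suc m)
  n : ℕ
  n = exp₂ (suc (suc m))
  preserves-∅ : spreadOddᵛ n (∅ {M}) ≡ ∅
  preserves-∅ = fromBits-false n λ t t< →
    trans (spreadOdd-cong M (λ p _ → bit-∅ M p) t t<) (spreadOdd-false t)
  preserves-⊕ : ∀ a b → spreadOddᵛ n (a ⊕ b) ≡ spreadOddᵛ n a ⊕ spreadOddᵛ n b
  preserves-⊕ a b = trans
    (fromBits-cong n λ t t< → trans (spreadOdd-cong M (λ p _ → bit-⊕ a b p) t t<) (spreadOdd-xor (bit a) (bit b) t))
    (fromBits-xor n (spreadOdd (bit a)) (spreadOdd (bit b)))
  generators : ∀ {a} → a ∈ₗ Cfam (suc m) M → spreadOddᵛ n a ∈⟨ Cfam (suc (suc m)) n ⟩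
  generators a∈ with ∈-map⁻ (toVertex M) a∈
  ... | l , l∈ , refl = subst (_∈⟨ Cfam (suc (suc m)) n ⟩)
    (fromBits-cong n λ t t< →
       trans (indicator-double l t) (sym (spreadOdd-cong M (λ p p< → bit-fromBits M (indicator l) p p<) t t<)))
    (∈⟨⟩-member (∈-map⁺ (toVertex n) (∈-++⁺ʳ (O (suc (suc m))) (∈-map⁺ (List.map (2 *_)) l∈))))

fromBits-spreadOdd : ∀ m g → fromBits (double m) (spreadOdd g) ≡ spreadOddᵛ (double m) (fromBits m g)
fromBits-spreadOdd m g = fromBits-cong (double m) λ t t< →
  sym (spreadOdd-cong m (λ p p< → bit-fromBits m g p p<) t t<)

ParityChecks⇒∈⟨C⟩ : ∀ k {f} → ParityChecks k f → fromBits (exp₂ k) f ∈⟨ Cfam k (exp₂ k) ⟩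
ParityChecks⇒∈⟨C⟩ zero {f} f0 = subst (_∈⟨ List.[] ⟩) (sym (fromBits-false 1 vanish)) span-∅
  where
  vanish : ∀ t → t < 1 → f t ≡ false
  vanish zero _ = f0
  vanish (suc t) (s≤s ())
ParityChecks⇒∈⟨C⟩ (suc zero) {f} (f0 , f1) = subst (_∈⟨ List.[] ⟩) (sym (fromBits-false 2 vanish)) span-∅
  where
  vanish : ∀ t → t < 2 → f t ≡ false
  vanish zero       _ = f0
  vanish (suc zero) _ = f1
  vanish (suc (suc t)) (s≤s (s≤s ()))
ParityChecks⇒∈⟨C⟩ (suc (suc m)) {f} (evenCheck , oddChecks) =
  subst (_∈⟨ Cfam (suc (suc m)) n ⟩) (sym split)
    (∈⟨⟩-⊕ evenPart (spreadOddᵛ-∈⟨C⟩ m (ParityChecks⇒∈⟨C⟩ (suc m) {f ∘ suc ∘ double} oddChecks)))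
  where
  M : ℕ
  M = exp₂ (suc m)
  n : ℕ
  n = exp₂ (suc (suc m))
  split : fromBits n f ≡ fromBits n (spreadEven (f ∘ double)) ⊕ spreadOddᵛ n (fromBits M (f ∘ suc ∘ double))
  split = trans (fromBits-cong n (λ t _ → spread-split f t))
         (trans (fromBits-xor n (spreadEven (f ∘ double)) (spreadOdd (f ∘ suc ∘ double)))
                (cong (fromBits n (spreadEven (f ∘ double)) ⊕_) (fromBits-spreadOdd M (f ∘ suc ∘ double))))
  evenPart : fromBits n (spreadEven (f ∘ double)) ∈⟨ Cfam (suc (suc m)) n ⟩
  evenPart = spreadEven-∈⟨C⟩ m M ≤-refl evenCheck (λ p M≤p p<M → contradiction p<M (≤⇒≯ M≤p))

flipAt : ∀ {n m} → Vec (Fin n) m → ℕ → ℕ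
flipAt []       r       = 0
flipAt (i ∷ is) zero    = toℕ i
flipAt (i ∷ is) (suc r) = flipAt is r

lookup-trace-zero : ∀ {n m} (x : Vertex n) (is : Vec (Fin n) m) → lookup (trace x is) fzero ≡ x
lookup-trace-zero x []      = refl
lookup-trace-zero x (_ ∷ _) = refl

lookup-trace-suc : ∀ {n m} (x : Vertex n) (is : Vec (Fin n) m) (p : Fin m) →
  lookup (trace x is) (fsuc p) ≡ lookup (trace x is) (inject₁ p) ⊕ ⁅ lookup is p ⁆
lookup-trace-suc x (i ∷ is) fzero    = lookup-trace-zero (x ⊕ ⁅ i ⁆) is
lookup-trace-suc x (i ∷ is) (fsuc p) = lookup-trace-suc (x ⊕ ⁅ i ⁆) is p

bit-trace : ∀ {n m} (x : Vertex n) (is : Vec (Fin n) m) (p : Fin (suc m)) t → t < n →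
  bit (lookup (trace x is) p) t ≡ bit x t xor xorSum (λ r → flipAt is r ≡ᵇ t) (toℕ p)
bit-trace x []       fzero    t _ = sym (xor-identityʳ (bit x t))
bit-trace x (i ∷ is) fzero    t _ = sym (xor-identityʳ (bit x t))
bit-trace x (i ∷ is) (fsuc p) t t<n = begin
  bit (lookup (trace (x ⊕ ⁅ i ⁆) is) p) t
    ≡⟨ bit-trace (x ⊕ ⁅ i ⁆) is p t t<n ⟩
  bit (x ⊕ ⁅ i ⁆) t xor xorSum (λ r → flipAt is r ≡ᵇ t) (toℕ p)
    ≡⟨ cong (_xor xorSum (λ r → flipAt is r ≡ᵇ t) (toℕ p)) bit-flip ⟩
  (bit x t xor (toℕ i ≡ᵇ t)) xor xorSum (λ r → flipAt is r ≡ᵇ t) (toℕ p)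
    ≡⟨ xor-assoc (bit x t) (toℕ i ≡ᵇ t) _ ⟩
  bit x t xor ((toℕ i ≡ᵇ t) xor xorSum (λ r → flipAt is r ≡ᵇ t) (toℕ p))
    ≡⟨ cong (bit x t xor_) (sym (xorSum-suc (toℕ p) (λ r → flipAt (i ∷ is) r ≡ᵇ t))) ⟩
  bit x t xor xorSum (λ r → flipAt (i ∷ is) r ≡ᵇ t) (suc (toℕ p)) ∎
  where
  open ≡-Reasoning
  bit-flip : bit (x ⊕ ⁅ i ⁆) t ≡ bit x t xor (toℕ i ≡ᵇ t)
  bit-flip = trans (bit-⊕ x ⁅ i ⁆ t)
                   (cong (bit x t xor_) (trans (bit-fromBits _ (_≡ᵇ toℕ i) t t<n) (≡ᵇ-sym t (toℕ i))))

flipAt-++ˡ : ∀ {n a b} (u : Vec (Fin n) a) (w : Vec (Fin n) b) r → r < a → flipAt (u ++ w) r ≡ flipAt u r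
flipAt-++ˡ (i ∷ u) w zero    _         = refl
flipAt-++ˡ (i ∷ u) w (suc r) (s≤s r<a) = flipAt-++ˡ u w r r<a

flipAt-++ʳ : ∀ {n a b} (u : Vec (Fin n) a) (w : Vec (Fin n) b) r → flipAt (u ++ w) (a + r) ≡ flipAt w r
flipAt-++ʳ []      w r = refl
flipAt-++ʳ (i ∷ u) w r = flipAt-++ʳ u w r

flipAt-allFin : ∀ n r → r < n → flipAt (allFin n) r ≡ r
flipAt-allFin n = go n 0 (λ j → j) (λ _ → refl)
  where
  go : ∀ {n} N c (h : Fin N → Fin n) → (∀ j → toℕ (h j) ≡ c + toℕ j) → ∀ r → r < N → flipAt (tabulate h) r ≡ c + r
  go (suc N) c h h≡ zero    _         = h≡ fzero
  go (suc N) c h h≡ (suc r) (s≤s r<N) =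
    trans (go N (suc c) (h ∘ fsuc) (λ j → trans (h≡ (fsuc j)) (+-suc c (toℕ j))) r r<N) (sym (+-suc c r))

+-≡ᵇ-+ : ∀ n t r → (t + n ≡ᵇ n + r) ≡ (t ≡ᵇ r)
+-≡ᵇ-+ n t r rewrite +-comm t n = go n
  where
  go : ∀ n → (n + t ≡ᵇ n + r) ≡ (t ≡ᵇ r)
  go zero    = refl
  go (suc n) = go n

flipAt-flips : ∀ n q t → q < n + n → t < n → (flipAt (flips n) q ≡ᵇ t) ≡ stepFlip n q t
flipAt-flips n q t q<2n t<n with q <? n
... | yes q<n rewrite flipAt-++ˡ (allFin n) (allFin n) q q<n | flipAt-allFin n q q<n
                    | ≢⇒≡ᵇ≡false {t + n} {q} (λ e → <-irrefl (sym e) (<-≤-trans q<n (m≤n+m n t))) =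
  trans (≡ᵇ-sym q t) (sym (xor-identityʳ (t ≡ᵇ q)))
... | no q≮n with m≤n⇒∃[o]m+o≡n (≮⇒≥ q≮n)
...   | r , refl rewrite flipAt-++ʳ (allFin n) (allFin n) r | flipAt-allFin n r (+-cancelˡ-< n r n q<2n)
                       | ≢⇒≡ᵇ≡false {t} {n + r} (λ e → <-irrefl e (<-≤-trans t<n (m≤m+n n r)))
                       | +-≡ᵇ-+ n t r = ≡ᵇ-sym r t

xorSum-flips : ∀ n q t → q ≤ n + n → t < n → xorSum (λ r → flipAt (flips n) r ≡ᵇ t) q ≡ walkSet n q t
xorSum-flips n zero    t _   _   = refl
xorSum-flips n (suc q) t q<2n t<n =
  trans (cong₂ _xor_ (xorSum-flips n q t (<⇒≤ q<2n) t<n) (flipAt-flips n q t q<2n t<n)) (sym (walkSet-suc n q t))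

bit-walkC : ∀ {n} (x : Vertex n) (p : Fin (suc (n + n))) t → t < n →
  bit (lookup (walkC x) p) t ≡ bit x t xor walkSet n (toℕ p) t
bit-walkC {n} x p t t<n =
  trans (bit-trace x (flips n) p t t<n) (cong (bit x t xor_) (xorSum-flips n (toℕ p) t (≤-pred (toℕ<n p)) t<n))

bit-cyc : ∀ {n} (x : Vertex n) (j : Fin (n + n)) t → t < n → bit (cyc x j) t ≡ bit x t xor walkSet n (toℕ j) t
bit-cyc {n} x j t t<n =
  trans (bit-walkC x (inject₁ j) t t<n) (cong (λ q → bit x t xor walkSet n q t) (toℕ-inject₁ j))

walkC-start : ∀ {n} (x : Vertex n) → lookup (walkC x) fzero ≡ x
walkC-start {n} x = lookup-trace-zero x (flips n)

walkC-end : ∀ {n} (x : Vertex n) → lookup (walkC x) (fromℕ (n + n)) ≡ x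
walkC-end {n} x = bit-ext λ t t<n → trans (bit-walkC x (fromℕ (n + n)) t t<n)
  (trans (cong (λ q → bit x t xor walkSet n q t) (toℕ-fromℕ (n + n)))
         (trans (cong (bit x t xor_) (closed t t<n)) (xor-identityʳ (bit x t))))
  where
  closed : ∀ t → t < n → walkSet n (n + n) t ≡ false
  closed t t<n rewrite <⇒<ᵇ≡true (<-≤-trans t<n (m≤m+n n n)) | <⇒<ᵇ≡true (+-monoˡ-< n t<n) = refl

⊕-cancelʳ : ∀ {n} (v e : Vertex n) → (v ⊕ e) ⊕ e ≡ v
⊕-cancelʳ v e = bit-ext λ t _ →
  trans (bit-⊕ (v ⊕ e) e t) (trans (cong (_xor bit e t) (bit-⊕ v e t)) (xor-cancelʳ (bit v t) (bit e t)))

CAdj-sym : ∀ {n} {x u v : Vertex n} → CAdj x u v → CAdj x v u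
CAdj-sym (j , inj₁ uv) = j , inj₂ uv
CAdj-sym (j , inj₂ vu) = j , inj₁ vu

CAdj⊆QAdj : ∀ {n} {x u v : Vertex n} → CAdj x u v → QAdj u v
CAdj⊆QAdj {n} {x} (j , inj₁ (refl , refl)) = lookup (flips n) j , lookup-trace-suc x (flips n) j
CAdj⊆QAdj {n} {x} (j , inj₂ (refl , refl)) = lookup (flips n) j ,
  trans (sym (⊕-cancelʳ _ ⁅ lookup (flips n) j ⁆))
        (cong (_⊕ ⁅ lookup (flips n) j ⁆) (sym (lookup-trace-suc x (flips n) j)))

module _ {V : Set} {E : V → V → Set} where

  _++ᵂ_ : ∀ {u v w a b} → Walk E u v a → Walk E v w b → Walk E u w (a + b)
  []      ++ᵂ q = q
  (e ∷ p) ++ᵂ q = e ∷ (p ++ᵂ q)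

  castᵂ : ∀ {u v a b} → a ≡ b → Walk E u v a → Walk E u v b
  castᵂ refl p = p

  reverseᵂ : (∀ {u v} → E u v → E v u) → ∀ {u v m} → Walk E u v m → Walk E v u m
  reverseᵂ E-sym []                = []
  reverseᵂ E-sym (_∷_ {m = m} e p) = castᵂ (+-comm m 1) (reverseᵂ E-sym p ++ᵂ (E-sym e ∷ []))

  segmentᵂ : ∀ {m} (vs : Vec V (suc m)) → (∀ j → E (lookup vs (inject₁ j)) (lookup vs (fsuc j))) →
    ∀ a b → toℕ a ≤ toℕ b → Walk E (lookup vs a) (lookup vs b) (toℕ b ∸ toℕ a)
  segmentᵂ {zero}  (v ∷ [])  step fzero    fzero    _         = []
  segmentᵂ {suc m} (v ∷ vs) step fzero    fzero    _         = []
  segmentᵂ {suc m} (v ∷ vs) step fzero    (fsuc b) _         = step fzero ∷ segmentᵂ vs (step ∘ fsuc) fzero b z≤n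
  segmentᵂ {suc m} (v ∷ vs) step (fsuc a) (fsuc b) (s≤s a≤b) = segmentᵂ vs (step ∘ fsuc) a b a≤b

mapᵂ : ∀ {V : Set} {E E′ : V → V → Set} → (∀ {u v} → E u v → E′ u v) → ∀ {u v m} → Walk E u v m → Walk E′ u v m
mapᵂ f []      = []
mapᵂ f (e ∷ p) = f e ∷ mapᵂ f p

IsDist-⇔ : ∀ {V : Set} {EH EG : V → V → Set} → (∀ {u v} → EH u v → EG u v) →
  ∀ {u v h} → Walk EH u v h → (∀ m → Walk EG u v m → h ≤ m) → ∀ d → IsDist EH u v d ⇔ IsDist EG u v d
IsDist-⇔ H⊆G {h = h} walk shortest d = mk⇔
  (λ (wH , minH) → mapᵂ H⊆G wH , λ m wG → ≤-trans (minH h walk) (shortest m wG))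
  (λ (wG , minG) → castᵂ (≤-antisym (shortest d wG) (minG h (mapᵂ H⊆G walk))) walk ,
                   λ m wH → ≤-trans (minG h (mapᵂ H⊆G walk)) (shortest m (mapᵂ H⊆G wH)))

count : (ℕ → Bool) → ℕ → ℕ
count f zero    = 0
count f (suc n) = if f 0 then suc (count (f ∘ suc) n) else count (f ∘ suc) n

count-cong : ∀ n {f g} → (∀ t → t < n → f t ≡ g t) → count f n ≡ count g n
count-cong zero    f≗g = refl
count-cong (suc n) f≗g =
  cong₂ (λ b c → if b then suc c else c) (f≗g 0 z<s) (count-cong n (λ t t<n → f≗g (suc t) (s<s t<n)))

count-false : ∀ n → count (λ _ → false) n ≡ 0
count-false zero    = refl
count-false (suc n) = count-false n

count-+ : ∀ m n f → count f (m + n) ≡ count f m + count (λ t → f (m + t)) n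
count-+ zero    n f = refl
count-+ (suc m) n f with f 0
... | true  = cong suc (count-+ m n (f ∘ suc))
... | false = count-+ m n (f ∘ suc)

count-xor-disjoint : ∀ n f g → (∀ t → t < n → f t ∧ g t ≡ false) →
  count (λ t → f t xor g t) n ≡ count f n + count g n
count-xor-disjoint zero    f g _        = refl
count-xor-disjoint (suc n) f g disjoint
  with f 0 | g 0 | disjoint 0 z<s | count-xor-disjoint n (f ∘ suc) (g ∘ suc) (λ t t<n → disjoint (suc t) (s<s t<n))
... | true  | true  | () | _
... | true  | false | _  | rest = cong suc rest
... | false | true  | _  | rest = trans (cong suc rest) (sym (+-suc (count (f ∘ suc) n) (count (g ∘ suc) n)))
... | false | false | _  | rest = rest

count-fold : ∀ n f → (∀ t → t < n → f t ∧ f (t + n) ≡ false) →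
  count (λ t → f t xor f (t + n)) n ≡ count f (n + n)
count-fold n f disjoint =
  trans (count-xor-disjoint n f (λ t → f (t + n)) disjoint)
        (trans (cong (count f n +_) (count-cong n (λ t _ → cong f (+-comm t n)))) (sym (count-+ n n f)))

count-not : ∀ n f → count (not ∘ f) n + count f n ≡ n
count-not zero    f = refl
count-not (suc n) f with f 0
... | true  = trans (+-suc (count (not ∘ f ∘ suc) n) (count (f ∘ suc) n)) (cong suc (count-not n (f ∘ suc)))
... | false = cong suc (count-not n (f ∘ suc))

count-<ᵇ : ∀ {j n} → j ≤ n → count (_<ᵇ j) n ≡ j
count-<ᵇ {zero}  {n}     _         = count-false n
count-<ᵇ {suc j} {suc n} (s≤s j≤n) = cong suc (count-<ᵇ j≤n)

interval : ℕ → ℕ → ℕ → Bool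
interval i j t = (t <ᵇ i) xor (t <ᵇ j)

count-interval : ∀ {i j n} → i ≤ j → j ≤ n → count (interval i j) n ≡ j ∸ i
count-interval {zero}  {j}     {n}     _         j≤n       = count-<ᵇ j≤n
count-interval {suc i} {suc j} {suc n} (s≤s i≤j) (s≤s j≤n) = count-interval i≤j j≤n

count-flip : ∀ n f i → count (λ t → f t xor (t ≡ᵇ i)) n ≤ suc (count f n)
count-flip zero    f i = z≤n
count-flip (suc n) f zero with f 0
... | true  = ≤-trans (≤-reflexive (count-cong n (λ t _ → xor-identityʳ (f (suc t)))))
                      (≤-trans (n≤1+n _) (n≤1+n _))
... | false = s≤s (≤-reflexive (count-cong n (λ t _ → xor-identityʳ (f (suc t)))))
count-flip (suc n) f (suc i) with f 0 | count-flip n (f ∘ suc) i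
... | true  | ih = s≤s ih
... | false | ih = ih

-- Distances along C(x)

hamming : ∀ {n} → Vertex n → Vertex n → ℕ
hamming {n} u v = count (λ t → bit u t xor bit v t) n

hamming-sym : ∀ {n} (u v : Vertex n) → hamming u v ≡ hamming v u
hamming-sym {n} u v = count-cong n (λ t _ → xor-comm (bit u t) (bit v t))

hamming-≤-length : ∀ {n} {u v : Vertex n} {m} → Walk QAdj u v m → hamming u v ≤ m
hamming-≤-length {n} {u} [] = ≤-reflexive (trans (count-cong n (λ t _ → xor-same (bit u t))) (count-false n))
hamming-≤-length {n} {u} {v} ((i , refl) ∷ p) =
  ≤-trans (≤-reflexive (count-cong n flip)) (≤-trans (count-flip n _ (toℕ i)) (s≤s (hamming-≤-length p)))
  where
  flip : ∀ t → t < n → bit u t xor bit v t ≡ (bit (u ⊕ ⁅ i ⁆) t xor bit v t) xor (t ≡ᵇ toℕ i)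
  flip t t<n rewrite bit-⊕ u ⁅ i ⁆ t | bit-fromBits n (_≡ᵇ toℕ i) t t<n =
    sym (trans (cong (_xor (t ≡ᵇ toℕ i)) (xy∙z≈xz∙y (bit u t) (t ≡ᵇ toℕ i) (bit v t)))
               (xor-cancelʳ (bit u t xor bit v t) (t ≡ᵇ toℕ i)))

walkSet-xor : ∀ n i j t → walkSet n i t xor walkSet n j t ≡ interval i j t xor interval i j (t + n)
walkSet-xor n i j t = xor-interchange (t <ᵇ i) (t + n <ᵇ i) (t <ᵇ j) (t + n <ᵇ j)

count-walkSet-near : ∀ n {i j} → i ≤ j → j ≤ i + n → j ≤ n + n →
  count (λ t → walkSet n i t xor walkSet n j t) n ≡ j ∸ i
count-walkSet-near n {i} {j} i≤j j≤i+n j≤2n =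
  trans (count-cong n (λ t _ → walkSet-xor n i j t))
        (trans (count-fold n (interval i j) disjoint) (count-interval i≤j j≤2n))
  where
  disjoint : ∀ t → t < n → interval i j t ∧ interval i j (t + n) ≡ false
  disjoint t t<n with t <? i
  ... | yes t<i rewrite <⇒<ᵇ≡true t<i | <⇒<ᵇ≡true (<-≤-trans t<i i≤j) = refl
  ... | no t≮i rewrite ≥⇒<ᵇ≡false {t + n} {i} (≤-trans (≮⇒≥ t≮i) (m≤m+n t n))
                     | ≥⇒<ᵇ≡false {t + n} {j} (≤-trans j≤i+n (+-monoˡ-≤ n (≮⇒≥ t≮i))) = ∧-zeroʳ _

count-walkSet-far : ∀ n {i j} → i + n ≤ j → j ≤ n + n →
  count (λ t → walkSet n i t xor walkSet n j t) n ≡ (n + n) ∸ (j ∸ i)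
count-walkSet-far n {i} {j} i+n≤j j≤2n = begin
  count (λ t → walkSet n i t xor walkSet n j t) n
    ≡⟨ count-cong n (λ t _ → trans (walkSet-xor n i j t) (sym (xor-annihilates-not (interval i j t) _))) ⟩
  count (λ t → not (interval i j t) xor not (interval i j (t + n))) n
    ≡⟨ count-fold n (not ∘ interval i j) cover ⟩
  count (not ∘ interval i j) (n + n)
    ≡⟨ sym (m+n∸n≡m _ (count (interval i j) (n + n))) ⟩
  count (not ∘ interval i j) (n + n) + count (interval i j) (n + n) ∸ count (interval i j) (n + n)
    ≡⟨ cong₂ _∸_ (count-not (n + n) (interval i j)) (count-interval (≤-trans (m≤m+n i n) i+n≤j) j≤2n) ⟩
  (n + n) ∸ (j ∸ i) ∎
  where
  open ≡-Reasoning
  cover : ∀ t → t < n → not (interval i j t) ∧ not (interval i j (t + n)) ≡ false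
  cover t t<n with t <? i
  ... | yes t<i rewrite ≥⇒<ᵇ≡false {t + n} {i} (≤-trans (+-cancelʳ-≤ n i n (≤-trans i+n≤j j≤2n)) (m≤n+m n t))
                      | <⇒<ᵇ≡true (<-≤-trans (+-monoˡ-< n t<i) i+n≤j) = ∧-zeroʳ _
  ... | no t≮i rewrite ≥⇒<ᵇ≡false {t} {i} (≮⇒≥ t≮i)
                     | <⇒<ᵇ≡true (<-≤-trans t<n (≤-trans (m≤n+m n i) i+n≤j)) = refl

m∸[n∸o]≡o+[m∸n] : ∀ {m n o} → o ≤ n → n ≤ m → m ∸ (n ∸ o) ≡ o + (m ∸ n)
m∸[n∸o]≡o+[m∸n] {m} {n} {o} o≤n n≤m with m≤n⇒∃[o]m+o≡n o≤n | m≤n⇒∃[o]m+o≡n n≤m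
... | a , refl | b , refl = begin
  o + a + b ∸ (o + a ∸ o)   ≡⟨ cong (o + a + b ∸_) (m+n∸m≡n o a) ⟩
  o + a + b ∸ a             ≡⟨ cong (_∸ a) (trans (cong (_+ b) (+-comm o a)) (+-assoc a o b)) ⟩
  a + (o + b) ∸ a           ≡⟨ m+n∸m≡n a (o + b) ⟩
  o + b                     ≡⟨ cong (o +_) (sym (m+n∸m≡n (o + a) b)) ⟩
  o + (o + a + b ∸ (o + a)) ∎
  where open ≡-Reasoning

hamming-cyc : ∀ {n} (x : Vertex n) (i j : Fin (n + n)) →
  hamming (cyc x i) (cyc x j) ≡ count (λ t → walkSet n (toℕ i) t xor walkSet n (toℕ j) t) n
hamming-cyc {n} x i j = count-cong n λ t t<n →
  trans (cong₂ _xor_ (bit-cyc x i t t<n) (bit-cyc x j t t<n))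
        (xor-cancel-common (bit x t) (walkSet n (toℕ i) t) (walkSet n (toℕ j) t))

cyc-step : ∀ {n} (x : Vertex n) (j : Fin (n + n)) →
  CAdj x (lookup (walkC x) (inject₁ j)) (lookup (walkC x) (fsuc j))
cyc-step x j = j , inj₁ (refl , refl)

cyc-forward : ∀ {n} (x : Vertex n) (i j : Fin (n + n)) → toℕ i ≤ toℕ j →
  Walk (CAdj x) (cyc x i) (cyc x j) (toℕ j ∸ toℕ i)
cyc-forward x i j i≤j = castᵂ (cong₂ _∸_ (toℕ-inject₁ j) (toℕ-inject₁ i))
  (segmentᵂ (walkC x) (cyc-step x) (inject₁ i) (inject₁ j)
    (subst₂ _≤_ (sym (toℕ-inject₁ i)) (sym (toℕ-inject₁ j)) i≤j))

-- back from i to the start, which is also the end, and back from the end to j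
cyc-backward : ∀ {n} (x : Vertex n) (i j : Fin (n + n)) →
  Walk (CAdj x) (cyc x i) (cyc x j) (toℕ i + (n + n ∸ toℕ j))
cyc-backward {n} x i j = castᵂ (cong₂ _+_ (toℕ-inject₁ i) (cong₂ _∸_ (toℕ-fromℕ (n + n)) (toℕ-inject₁ j)))
  (reverseᵂ CAdj-sym (segmentᵂ (walkC x) (cyc-step x) fzero (inject₁ i) z≤n) ++ᵂ
   subst (λ v → Walk (CAdj x) v (cyc x j) _) (trans (walkC-end x) (sym (walkC-start x)))
     (reverseᵂ CAdj-sym (segmentᵂ (walkC x) (cyc-step x) (inject₁ j) (fromℕ (n + n)) j≤2n)))
  where
  j≤2n : toℕ (inject₁ j) ≤ toℕ (fromℕ (n + n))
  j≤2n = subst₂ _≤_ (sym (toℕ-inject₁ j)) (sym (toℕ-fromℕ (n + n))) (<⇒≤ (toℕ<n j))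

cyc-geodesic-≤ : ∀ {n} (x : Vertex n) (i j : Fin (n + n)) → toℕ i ≤ toℕ j →
  Walk (CAdj x) (cyc x i) (cyc x j) (hamming (cyc x i) (cyc x j))
cyc-geodesic-≤ {n} x i j i≤j with toℕ j ≤? toℕ i + n
... | yes near = castᵂ (sym (trans (hamming-cyc x i j) (count-walkSet-near n i≤j near (<⇒≤ (toℕ<n j)))))
                      (cyc-forward x i j i≤j)
... | no far = castᵂ (sym (trans (hamming-cyc x i j)
                  (trans (count-walkSet-far n (<⇒≤ (≰⇒> far)) (<⇒≤ (toℕ<n j)))
                         (m∸[n∸o]≡o+[m∸n] i≤j (<⇒≤ (toℕ<n j))))))
               (cyc-backward x i j)

cyc-geodesic : ∀ {n} (x : Vertex n) (i j : Fin (n + n)) →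
  Walk (CAdj x) (cyc x i) (cyc x j) (hamming (cyc x i) (cyc x j))
cyc-geodesic x i j with toℕ i ≤? toℕ j
... | yes i≤j = cyc-geodesic-≤ x i j i≤j
... | no  i≰j = castᵂ (hamming-sym (cyc x j) (cyc x i)) (reverseᵂ CAdj-sym (cyc-geodesic-≤ x j i (<⇒≤ (≰⇒> i≰j))))

cyc-isometric : ∀ {n} (x : Vertex n) → Isometric (OnC x) (CAdj x) QAdj
cyc-isometric x _ _ (i , refl) (j , refl) = IsDist-⇔ CAdj⊆QAdj (cyc-geodesic x i j) (λ _ → hamming-≤-length)

-- The cycles partition Q_n

last≡lookup-fromℕ : ∀ {A : Set} {m} (xs : Vec A (suc m)) → last xs ≡ lookup xs (fromℕ m)
last≡lookup-fromℕ (x ∷ [])     = refl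
last≡lookup-fromℕ (x ∷ y ∷ xs) = last≡lookup-fromℕ (y ∷ xs)

cyc-closed : ∀ {n} (x : Vertex n) → cycEnd x ≡ x
cyc-closed x = trans (last≡lookup-fromℕ (walkC x)) (walkC-end x)

toℕ<double : ∀ {n} (i : Fin (n + n)) → toℕ i < double n
toℕ<double {n} i = subst (toℕ i <_) (sym (double≡+ n)) (toℕ<n i)

cyc-index-unique : ∀ k {x y : Vertex (exp₂ k)} {i j} → x ∈⟨ Cfam k (exp₂ k) ⟩ → y ∈⟨ Cfam k (exp₂ k) ⟩ →
  cyc x i ≡ cyc y j → toℕ i ≡ toℕ j
cyc-index-unique k {x} {y} {i} {j} x∈ y∈ xi≡yj = walkSet-unique k (toℕ<double i) (toℕ<double j)
  (ParityChecks-cong k differ (ParityChecks-xor k (∈⟨C⟩⇒ParityChecks k x∈) (∈⟨C⟩⇒ParityChecks k y∈)))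
  where
  differ : ∀ t → t < exp₂ k → bit x t xor bit y t ≡ walkSet (exp₂ k) (toℕ i) t xor walkSet (exp₂ k) (toℕ j) t
  differ t t<n = xor-transpose {bit x t} {walkSet (exp₂ k) (toℕ i) t}
    (trans (sym (bit-cyc x i t t<n)) (trans (cong (λ v → bit v t) xi≡yj) (bit-cyc y j t t<n)))

cyc-injective : ∀ k {x : Vertex (exp₂ k)} → x ∈⟨ Cfam k (exp₂ k) ⟩ → ∀ i j → cyc x i ≡ cyc x j → i ≡ j
cyc-injective k x∈ i j xi≡xj = toℕ-injective (cyc-index-unique k x∈ x∈ xi≡xj)

cycles-disjoint : ∀ k (x y v : Vertex (exp₂ k)) → x ∈⟨ Cfam k (exp₂ k) ⟩ → y ∈⟨ Cfam k (exp₂ k) ⟩ →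
  OnC x v → OnC y v → x ≡ y
cycles-disjoint k x y v x∈ y∈ (i , xi≡v) (j , yj≡v) = bit-ext λ t t<n → begin
  bit x t                                          ≡⟨ base x i t t<n ⟩
  bit (cyc x i) t xor walkSet n (toℕ i) t          ≡⟨ cong₂ (λ u q → bit u t xor walkSet n q t) xi≡yj i≡j ⟩
  bit (cyc y j) t xor walkSet n (toℕ j) t          ≡⟨ sym (base y j t t<n) ⟩
  bit y t                                          ∎
  where
  open ≡-Reasoning
  n : ℕ
  n = exp₂ k
  xi≡yj : cyc x i ≡ cyc y j
  xi≡yj = trans xi≡v (sym yj≡v)
  i≡j : toℕ i ≡ toℕ j
  i≡j = cyc-index-unique k x∈ y∈ xi≡yj
  base : ∀ z l t → t < n → bit z t ≡ bit (cyc z l) t xor walkSet n (toℕ l) t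
  base z l t t<n = sym (trans (cong (_xor walkSet n (toℕ l) t) (bit-cyc z l t t<n)) (xor-cancelʳ (bit z t) _))

cycles-cover : ∀ k (v : Vertex (exp₂ k)) → ∃ λ x → x ∈⟨ Cfam k (exp₂ k) ⟩ × OnC x v
cycles-cover k v with walkSet-decompose k (bit v)
... | j , j<2n , checks = x , ParityChecks⇒∈⟨C⟩ k checks , fromℕ< j<n+n , bit-ext onCycle
  where
  n : ℕ
  n = exp₂ k
  x : Vertex n
  x = fromBits n (λ t → bit v t xor walkSet n j t)
  j<n+n : j < n + n
  j<n+n = subst (j <_) (double≡+ n) j<2n
  onCycle : ∀ t → t < n → bit (cyc x (fromℕ< j<n+n)) t ≡ bit v t
  onCycle t t<n = begin
    bit (cyc x (fromℕ< j<n+n)) t                ≡⟨ bit-cyc x (fromℕ< j<n+n) t t<n ⟩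
    bit x t xor walkSet n (toℕ (fromℕ< j<n+n)) t ≡⟨ cong₂ (λ b q → b xor walkSet n q t)
                                                           (bit-fromBits n (λ t → bit v t xor walkSet n j t) t t<n)
                                                           (toℕ-fromℕ< j<n+n) ⟩
    (bit v t xor walkSet n j t) xor walkSet n j t ≡⟨ xor-cancelʳ (bit v t) (walkSet n j t) ⟩
    bit v t                                       ∎
    where open ≡-Reasoning

CyclePartition : ℕ → ℕ → Set
CyclePartition k n =
    (∀ (x : Vertex n) → x ∈⟨ Cfam k n ⟩ →
        (cycEnd x ≡ x)
      × (∀ (i j : Fin (n + n)) → cyc x i ≡ cyc x j → i ≡ j)
      × Isometric (OnC x) (CAdj x) QAdj)
    × (∀ (v : Vertex n) → ∃ λ x → x ∈⟨ Cfam k n ⟩ × OnC x v)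
    × (∀ (x y v : Vertex n) → x ∈⟨ Cfam k n ⟩ → y ∈⟨ Cfam k n ⟩ → OnC x v → OnC y v → x ≡ y)

cyclePartition : ∀ k → CyclePartition k (exp₂ k)
cyclePartition k =
  (λ x x∈ → cyc-closed x , cyc-injective k x∈ , cyc-isometric x) , cycles-cover k , cycles-disjoint k

-- The statement holds for k = 0 as well.
corollary2p4 : (k : ℕ) → 1 ≤ k →
    (∀ (x : Vertex (2 ^ k)) → x ∈⟨ Cfam k (2 ^ k) ⟩ →
        (cycEnd x ≡ x)
      × (∀ (i j : Fin (2 ^ k + 2 ^ k)) → cyc x i ≡ cyc x j → i ≡ j)
      × Isometric (OnC x) (CAdj x) QAdj)
    × (∀ (v : Vertex (2 ^ k)) → ∃ λ x → x ∈⟨ Cfam k (2 ^ k) ⟩ × OnC x v)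
    × (∀ (x y v : Vertex (2 ^ k)) → x ∈⟨ Cfam k (2 ^ k) ⟩ → y ∈⟨ Cfam k (2 ^ k) ⟩ →
        OnC x v → OnC y v → x ≡ y)
corollary2p4 k _ = subst (CyclePartition k) (exp₂≡2^ k) (cyclePartition k)
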